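{- If a finite lattice $L$ has dimension at most two and each of its antichains generates a distributive sublattice of $L$, then $L$ is an MI-lattice.
   Context: The dimension of an ordered set $P$ is the least number of chains whose product contains an order-embedding of $P$. An MI-ordering of an antichain $\mathcal{A}$ in a lattice $L$ is a listing $a_1,\ldots,a_t$ of the elements of $\mathcal{A}$ such that (i) $a_i\lor a_{i+1}\lor\cdots\lor a_k=a_i\lor a_k$ for all $1\le i<k\le t$, and (ii) $(a_1\land\cdots\land a_k)\lor a_{k+1}=a_k\lor a_{k+1}$ for all $1<k<t$. An antichain is MI-orderable if it has an MI-ordering; an MI-lattice is a lattice all of whose antichains are MI-orderable. -}

module Defs where

open import Level using (Level; _⊔_; suc)
open import Data.List using (List; []; _∷_; _++_; [_])
open import Data.List.Relation.Unary.AllPairs using (AllPairs)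
open import Data.List.Relation.Binary.Permutation.Propositional using (_↭_)
import Data.List.Relation.Unary.Enumerates.Setoid as Enum
import Data.List.Membership.Setoid as SetoidMem
open import Data.Product using (Σ; _×_; proj₁; proj₂)
open import Relation.Binary.PropositionalEquality using (_≡_)
open import Relation.Nullary using (¬_)
open import Relation.Binary.Bundles using (TotalOrder)
open import Relation.Binary.Lattice.Bundles using (Lattice)

module _ {c ℓ₁ ℓ₂ : Level} (L : Lattice c ℓ₁ ℓ₂) where
  open Lattice L

  FiniteLattice : Set (c ⊔ ℓ₁)
  FiniteLattice = Σ (List Carrier) (Enum.IsEnumeration setoid)

  IsOrderEmbedding₂ : ∀ {c' ℓ₁' ℓ₂'} (C₁ C₂ : TotalOrder c' ℓ₁' ℓ₂') →
    (Carrier → TotalOrder.Carrier C₁ × TotalOrder.Carrier C₂) → Set (c ⊔ ℓ₂ ⊔ ℓ₂')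
  IsOrderEmbedding₂ C₁ C₂ f = ∀ x y →
    (x ≤ y → (TotalOrder._≤_ C₁ (proj₁ (f x)) (proj₁ (f y))
              × TotalOrder._≤_ C₂ (proj₂ (f x)) (proj₂ (f y))))
    × ((TotalOrder._≤_ C₁ (proj₁ (f x)) (proj₁ (f y))
              × TotalOrder._≤_ C₂ (proj₂ (f x)) (proj₂ (f y))) → x ≤ y)

  -- dim L ≤ 2: L order-embeds into a product of two chains.
  DimAtMostTwo : Set (suc (c ⊔ ℓ₁ ⊔ ℓ₂))
  DimAtMostTwo = Σ (TotalOrder c ℓ₁ ℓ₂) λ C₁ → Σ (TotalOrder c ℓ₁ ℓ₂) λ C₂ →
    Σ (Carrier → TotalOrder.Carrier C₁ × TotalOrder.Carrier C₂) λ f →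
      IsOrderEmbedding₂ C₁ C₂ f

  Incomparable : Carrier → Carrier → Set ℓ₂
  Incomparable x y = ¬ (x ≤ y) × ¬ (y ≤ x)

  -- An antichain, given as a list of its elements (pairwise incomparable,
  -- hence in particular pairwise distinct).
  IsAntichain : List Carrier → Set (c ⊔ ℓ₂)
  IsAntichain = AllPairs Incomparable

  data Generated (as : List Carrier) : Carrier → Set (c ⊔ ℓ₁) where
    gen  : ∀ {x} → SetoidMem._∈_ setoid x as → Generated as x
    join : ∀ {x y} → Generated as x → Generated as y → Generated as (x ∨ y)
    meet : ∀ {x y} → Generated as x → Generated as y → Generated as (x ∧ y)

  GeneratesDistributive : List Carrier → Set (c ⊔ ℓ₁)
  GeneratesDistributive as = ∀ {x y z} → Generated as x → Generated as y → Generated as z →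
    x ∧ (y ∨ z) ≈ (x ∧ y) ∨ (x ∧ z)

  join⁺ : Carrier → List Carrier → Carrier
  join⁺ x [] = x
  join⁺ x (y ∷ ys) = x ∨ join⁺ y ys

  meet⁺ : Carrier → List Carrier → Carrier
  meet⁺ x [] = x
  meet⁺ x (y ∷ ys) = x ∧ meet⁺ y ys

  -- A listing bs = a₁,…,a_t satisfying the two MI conditions.
  -- (i): for every i < k, writing bs = pre ++ aᵢ ∷ mid ++ aₖ ∷ post,
  --      aᵢ ∨ … ∨ aₖ ≈ aᵢ ∨ aₖ.
  -- (ii): for every 1 < k < t, writing bs = a₁ ∷ mid ++ aₖ ∷ aₖ₊₁ ∷ post,
  --      (a₁ ∧ … ∧ aₖ) ∨ aₖ₊₁ ≈ aₖ ∨ aₖ₊₁.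
  IsMIListing : List Carrier → Set (c ⊔ ℓ₁)
  IsMIListing bs =
    (∀ pre x mid y post → bs ≡ pre ++ x ∷ mid ++ y ∷ post →
       join⁺ x (mid ++ [ y ]) ≈ x ∨ y)
    × (∀ a₁ mid x y post → bs ≡ a₁ ∷ mid ++ x ∷ y ∷ post →
       meet⁺ a₁ (mid ++ [ x ]) ∨ y ≈ x ∨ y)

  MIOrderable : List Carrier → Set (c ⊔ ℓ₁)
  MIOrderable as = Σ (List Carrier) λ bs → (bs ↭ as) × IsMIListing bs

  MILattice : Set (c ⊔ ℓ₁ ⊔ ℓ₂)
  MILattice = ∀ as → IsAntichain as → MIOrderable as

{-# OPTIONS --safe #-}
-- Embed L in a product of two chains C₁ × C₂. Incomparable elements are ordered one way
-- in C₁ and the other way in C₂, so listing an antichain by C₁ gives a sequence in which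
-- aᵢ ∧ aₖ ≤ aⱼ ≤ aᵢ ∨ aₖ whenever i < j < k. Condition (i) follows at once, and
-- a₁ ∧ ⋯ ∧ aₖ collapses to a₁ ∧ aₖ. Since aₖ ≤ a₁ ∨ aₖ₊₁, distributivity of the
-- sublattice generated by the antichain gives aₖ = (aₖ ∧ a₁) ∨ (aₖ ∧ aₖ₊₁) ≤ (a₁ ∧ aₖ) ∨ aₖ₊₁,
-- which is condition (ii).
module Submission where

open import Data.Product using (Σ; _×_; _,_; proj₁; proj₂; swap)
open import Data.Sum using (inj₁; inj₂)
open import Data.Empty using (⊥-elim)
open import Data.List using (List; []; _∷_; _++_; [_]; foldr)
open import Data.List.Properties using (++-assoc)
open import Data.List.Relation.Unary.All using (All; []; _∷_)
import Data.List.Relation.Unary.All as All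
import Data.List.Relation.Unary.All.Properties as All
open import Data.List.Relation.Unary.AllPairs using (AllPairs; []; _∷_)
import Data.List.Relation.Unary.AllPairs as AllPairs
open import Data.List.Relation.Unary.Any using (here; there)
import Data.List.Relation.Unary.Any as Any
open import Data.List.Membership.Propositional using (_∈_)
open import Data.List.Membership.Propositional.Properties using (∈-++⁺ʳ)
open import Data.List.Relation.Binary.Permutation.Propositional
  using (_↭_; ↭-refl; ↭-prep; ↭-swap; ↭-trans; ↭-sym; ↭⇒↭ₛ)
open import Data.List.Relation.Binary.Permutation.Propositional.Properties
  using (All-resp-↭; ∈-resp-↭)
import Data.List.Relation.Binary.Permutation.Setoid.Properties as Permutationₛ
open import Relation.Binary.Core using (Rel)
open import Relation.Binary.Definitions using (Total; Transitive)
open import Relation.Binary.PropositionalEquality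
  using (_≡_; refl; sym; cong; subst; resp₂)
import Relation.Binary.PropositionalEquality as ≡
open import Relation.Binary.Bundles using (TotalOrder)
open import Relation.Binary.Lattice.Bundles using (Lattice)
import Relation.Binary.Lattice.Properties.Lattice as LatticeProperties
import Relation.Binary.Lattice.Properties.JoinSemilattice as JoinSemilatticeProperties
import Relation.Binary.Reasoning.PartialOrder as ≤-Reasoning

open import Defs

module InsertionSort {a r} {A : Set a} {_≼_ : Rel A r}
  (≼-total : Total _≼_) (≼-trans : Transitive _≼_) where

  insert : A → List A → List A
  insert x [] = [ x ]
  insert x (y ∷ ys) with ≼-total x y
  ... | inj₁ _ = x ∷ y ∷ ys
  ... | inj₂ _ = y ∷ insert x ys

  insert-↭ : ∀ x ys → insert x ys ↭ x ∷ ys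
  insert-↭ x [] = ↭-refl
  insert-↭ x (y ∷ ys) with ≼-total x y
  ... | inj₁ _ = ↭-refl
  ... | inj₂ _ = ↭-trans (↭-prep y (insert-↭ x ys)) (↭-swap y x ↭-refl)

  insert-sorted : ∀ x {ys} → AllPairs _≼_ ys → AllPairs _≼_ (insert x ys)
  insert-sorted x {[]} [] = [] ∷ []
  insert-sorted x {y ∷ ys} (y≼ys ∷ ys-sorted) with ≼-total x y
  ... | inj₁ x≼y = (x≼y ∷ All.map (≼-trans x≼y) y≼ys) ∷ y≼ys ∷ ys-sorted
  ... | inj₂ y≼x =
    All-resp-↭ (↭-sym (insert-↭ x ys)) (y≼x ∷ y≼ys) ∷ insert-sorted x ys-sorted

  sort : List A → List A
  sort = foldr insert []

  sort-↭ : ∀ xs → sort xs ↭ xs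
  sort-↭ [] = ↭-refl
  sort-↭ (x ∷ xs) = ↭-trans (insert-↭ x (sort xs)) (↭-prep x (sort-↭ xs))

  sort-sorted : ∀ xs → AllPairs _≼_ (sort xs)
  sort-sorted [] = []
  sort-sorted (x ∷ xs) = insert-sorted x (sort-sorted xs)

module _ {a r} {A : Set a} {R : Rel A r} where

  AllPairs-++⁻ : ∀ xs {ys} → AllPairs R (xs ++ ys) → AllPairs R xs × AllPairs R ys
  AllPairs-++⁻ [] pairs = [] , pairs
  AllPairs-++⁻ (x ∷ xs) (x~ ∷ pairs) with AllPairs-++⁻ xs pairs
  ... | xs-pairs , ys-pairs = All.++⁻ˡ xs x~ ∷ xs-pairs , ys-pairs

  AllPairs-infix : ∀ pre seg post → AllPairs R (pre ++ seg ++ post) → AllPairs R seg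
  AllPairs-infix pre seg post pairs =
    proj₁ (AllPairs-++⁻ seg (proj₂ (AllPairs-++⁻ pre pairs)))

  AllPairs-segment : ∀ pre x mid y post → AllPairs R (pre ++ x ∷ mid ++ y ∷ post) →
    AllPairs R (x ∷ mid ++ [ y ])
  AllPairs-segment pre x mid y post pairs = AllPairs-infix pre (x ∷ mid ++ [ y ]) post
    (subst (AllPairs R) (cong (λ zs → pre ++ x ∷ zs) (sym (++-assoc mid [ y ] post))) pairs)

  AllPairs-++-[_]⁻ : ∀ y xs → AllPairs R (xs ++ [ y ]) → All (λ x → R x y) xs
  AllPairs-++-[ y ]⁻ [] _ = []
  AllPairs-++-[ y ]⁻ (x ∷ xs) (x~ ∷ pairs) =
    All.head (All.++⁻ʳ xs x~) ∷ AllPairs-++-[ y ]⁻ xs pairs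

module LatticeBounds {c ℓ₁ ℓ₂} (L : Lattice c ℓ₁ ℓ₂) where
  open Lattice L renaming (refl to ≤-refl; trans to ≤-trans)

  ≤-join⁺ : ∀ {w} z zs → w ∈ z ∷ zs → w ≤ join⁺ L z zs
  ≤-join⁺ z [] (here refl) = ≤-refl
  ≤-join⁺ z (z′ ∷ zs) (here refl) = x≤x∨y _ _
  ≤-join⁺ z (z′ ∷ zs) (there w∈zs) = ≤-trans (≤-join⁺ z′ zs w∈zs) (y≤x∨y _ _)

  join⁺-least : ∀ {u} z zs → z ≤ u → All (_≤ u) zs → join⁺ L z zs ≤ u
  join⁺-least z [] z≤u [] = z≤u
  join⁺-least z (z′ ∷ zs) z≤u (z′≤u ∷ zs≤u) = ∨-least z≤u (join⁺-least z′ zs z′≤u zs≤u)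

  [a∧x]∨y≈x∨y : ∀ {a x y} → x ≤ a ∨ y → x ∧ (a ∨ y) ≈ (x ∧ a) ∨ (x ∧ y) →
    (a ∧ x) ∨ y ≈ x ∨ y
  [a∧x]∨y≈x∨y {a} {x} {y} x≤a∨y distrib =
    antisym (∨-monotonic (x∧y≤y a x) ≤-refl) (∨-least x≤[a∧x]∨y (y≤x∨y _ _))
    where
    open JoinSemilatticeProperties joinSemilattice using (∨-monotonic)
    open ≤-Reasoning poset
    x≤[a∧x]∨y : x ≤ (a ∧ x) ∨ y
    x≤[a∧x]∨y = begin
      x                   ≤⟨ ∧-greatest ≤-refl x≤a∨y ⟩
      x ∧ (a ∨ y)         ≈⟨ distrib ⟩
      (x ∧ a) ∨ (x ∧ y)   ≤⟨ ∨-monotonic (∧-greatest (x∧y≤y x a) (x∧y≤x x a)) (x∧y≤y x y) ⟩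
      (a ∧ x) ∨ y         ∎

module Segments {c ℓ₁ ℓ₂ r} (L : Lattice c ℓ₁ ℓ₂) {_◁_ : Rel (Lattice.Carrier L) r}
  (◁-between : ∀ {a m b} → a ◁ m → m ◁ b → Lattice._≤_ L m (Lattice._∨_ L a b)) where
  open Lattice L hiding (refl)
  open LatticeBounds L

  segment-≤-∨ : ∀ {x y} mid → AllPairs _◁_ (x ∷ mid ++ [ y ]) → All (_≤ x ∨ y) (mid ++ [ y ])
  segment-≤-∨ {y = y} mid (x◁ ∷ pairs) =
    All.++⁺ (All.zipWith (λ (x◁m , m◁y) → ◁-between x◁m m◁y)
                         (All.++⁻ˡ mid x◁ , AllPairs-++-[ y ]⁻ mid pairs))
            (y≤x∨y _ _ ∷ [])

  join⁺-segment : ∀ {x y} mid → AllPairs _◁_ (x ∷ mid ++ [ y ]) → join⁺ L x (mid ++ [ y ]) ≈ x ∨ y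
  join⁺-segment {x} {y} mid pairs = antisym
    (join⁺-least x (mid ++ [ y ]) (x≤x∨y _ _) (segment-≤-∨ mid pairs))
    (∨-least (≤-join⁺ x (mid ++ [ y ]) (here refl))
             (≤-join⁺ x (mid ++ [ y ]) (there (∈-++⁺ʳ mid (here refl)))))

module MIListings {c ℓ₁ ℓ₂ r} (L : Lattice c ℓ₁ ℓ₂) {_◁_ : Rel (Lattice.Carrier L) r}
  (◁-≤-∨ : ∀ {a m b} → a ◁ m → m ◁ b → Lattice._≤_ L m (Lattice._∨_ L a b))
  (◁-∧-≤ : ∀ {a m b} → a ◁ m → m ◁ b → Lattice._≤_ L (Lattice._∧_ L a b) m) where
  open Lattice L hiding (refl)
  open LatticeBounds L using ([a∧x]∨y≈x∨y)
  open Segments L ◁-≤-∨ using (join⁺-segment)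
  open LatticeProperties L using (∧-∨-lattice)
  -- In the order-dual lattice ◁-∧-≤ reads as ◁-≤-∨.
  open Segments ∧-∨-lattice ◁-∧-≤ using () renaming (join⁺-segment to dual-join⁺-segment)

  meet⁺≡dual-join⁺ : ∀ z zs → meet⁺ L z zs ≡ join⁺ ∧-∨-lattice z zs
  meet⁺≡dual-join⁺ z [] = refl
  meet⁺≡dual-join⁺ z (z′ ∷ zs) = cong (z ∧_) (meet⁺≡dual-join⁺ z′ zs)

  meet⁺-segment : ∀ {x y} mid → AllPairs _◁_ (x ∷ mid ++ [ y ]) → meet⁺ L x (mid ++ [ y ]) ≈ x ∧ y
  meet⁺-segment {x} mid pairs =
    Eq.trans (Eq.reflexive (meet⁺≡dual-join⁺ x (mid ++ [ _ ]))) (dual-join⁺-segment mid pairs)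

  sorted⇒IsMIListing : ∀ {bs} → AllPairs _◁_ bs →
    (∀ {x y z} → x ∈ bs → y ∈ bs → z ∈ bs → x ∧ (y ∨ z) ≈ (x ∧ y) ∨ (x ∧ z)) →
    IsMIListing L bs
  sorted⇒IsMIListing {bs} sorted distrib = joins , meets
    where
    joins : ∀ pre x mid y post → bs ≡ pre ++ x ∷ mid ++ y ∷ post →
      join⁺ L x (mid ++ [ y ]) ≈ x ∨ y
    joins pre x mid y post refl = join⁺-segment mid (AllPairs-segment pre x mid y post sorted)

    meets : ∀ a₁ mid x y post → bs ≡ a₁ ∷ mid ++ x ∷ y ∷ post →
      meet⁺ L a₁ (mid ++ [ x ]) ∨ y ≈ x ∨ y
    meets a₁ mid x y post refl = begin
      meet⁺ L a₁ (mid ++ [ x ]) ∨ y  ≈⟨ ∨-cong (meet⁺-segment mid segment) Eq.refl ⟩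
      (a₁ ∧ x) ∨ y                   ≈⟨ [a∧x]∨y≈x∨y (◁-≤-∨ a₁◁x x◁y) (distrib x∈bs a₁∈bs y∈bs) ⟩
      x ∨ y                          ∎
      where
      open JoinSemilatticeProperties joinSemilattice using (∨-cong)
      open import Relation.Binary.Reasoning.Setoid setoid
      segment : AllPairs _◁_ (a₁ ∷ mid ++ [ x ])
      segment = AllPairs-segment [] a₁ mid x (y ∷ post) sorted
      a₁◁x : a₁ ◁ x
      a₁◁x = All.head (All.++⁻ʳ mid (AllPairs.head segment))
      x◁y : x ◁ y
      x◁y = All.head (AllPairs.head (AllPairs-infix (a₁ ∷ mid) (x ∷ [ y ]) post sorted))
      a₁∈bs : a₁ ∈ a₁ ∷ mid ++ x ∷ y ∷ post
      a₁∈bs = here refl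
      x∈bs : x ∈ a₁ ∷ mid ++ x ∷ y ∷ post
      x∈bs = there (∈-++⁺ʳ mid (here refl))
      y∈bs : y ∈ a₁ ∷ mid ++ x ∷ y ∷ post
      y∈bs = there (∈-++⁺ʳ mid (there (here refl)))

module TwoChains {c ℓ₁ ℓ₂ c′ ℓ₁′ ℓ₂′} (L : Lattice c ℓ₁ ℓ₂) (C₁ C₂ : TotalOrder c′ ℓ₁′ ℓ₂′)
  (f : Lattice.Carrier L → TotalOrder.Carrier C₁ × TotalOrder.Carrier C₂)
  (f-embedding : IsOrderEmbedding₂ L C₁ C₂ f) where
  open Lattice L
  private
    module C₁ = TotalOrder C₁
    module C₂ = TotalOrder C₂

  f₁ : Carrier → C₁.Carrier
  f₁ x = proj₁ (f x)

  f₂ : Carrier → C₂.Carrier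
  f₂ x = proj₂ (f x)

  _◁_ : Rel Carrier ℓ₂′
  x ◁ y = f₁ x C₁.≤ f₁ y × f₂ y C₂.≤ f₂ x

  ◁-≤-∨ : ∀ {a m b} → a ◁ m → m ◁ b → m ≤ a ∨ b
  ◁-≤-∨ {a} {m} {b} (_ , m≤₂a) (m≤₁b , _) =
    let (_ , a≤₂a∨b) = proj₁ (f-embedding a (a ∨ b)) (x≤x∨y a b)
        (b≤₁a∨b , _) = proj₁ (f-embedding b (a ∨ b)) (y≤x∨y a b)
    in proj₂ (f-embedding m (a ∨ b)) (C₁.trans m≤₁b b≤₁a∨b , C₂.trans m≤₂a a≤₂a∨b)

  ◁-∧-≤ : ∀ {a m b} → a ◁ m → m ◁ b → a ∧ b ≤ m
  ◁-∧-≤ {a} {m} {b} (a≤₁m , _) (_ , b≤₂m) =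
    let (a∧b≤₁a , _) = proj₁ (f-embedding (a ∧ b) a) (x∧y≤x a b)
        (_ , a∧b≤₂b) = proj₁ (f-embedding (a ∧ b) b) (x∧y≤y a b)
    in proj₂ (f-embedding (a ∧ b) m) (C₁.trans a∧b≤₁a a≤₁m , C₂.trans a∧b≤₂b b≤₂m)

  incomparable⇒◁ : ∀ {x y} → Incomparable L x y → f₁ x C₁.≤ f₁ y → x ◁ y
  incomparable⇒◁ {x} {y} (x≰y , _) x≤₁y with C₂.total (f₂ x) (f₂ y)
  ... | inj₁ x≤₂y = ⊥-elim (x≰y (proj₂ (f-embedding x y) (x≤₁y , x≤₂y)))
  ... | inj₂ y≤₂x = x≤₁y , y≤₂x

  open InsertionSort {_≼_ = λ x y → f₁ x C₁.≤ f₁ y} (λ x y → C₁.total (f₁ x) (f₁ y)) C₁.trans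

  antichain-◁-listing : ∀ {as} → IsAntichain L as → Σ (List Carrier) λ bs → bs ↭ as × AllPairs _◁_ bs
  antichain-◁-listing {as} antichain =
    sort as , sort-↭ as ,
    AllPairs.zipWith (λ (incomparable , x≤₁y) → incomparable⇒◁ incomparable x≤₁y)
      (Permutationₛ.AllPairs-resp-↭ (≡.setoid Carrier) swap (resp₂ (Incomparable L))
         (↭⇒↭ₛ (↭-sym (sort-↭ as))) antichain ,
       sort-sorted as)

lemma3p10 : ∀ {c ℓ₁ ℓ₂} (L : Lattice c ℓ₁ ℓ₂) →
    FiniteLattice L →
    DimAtMostTwo L →
    (∀ as → IsAntichain L as → GeneratesDistributive L as) →
    MILattice L
lemma3p10 L _ (C₁ , C₂ , f , f-embedding) antichains-distributive as antichain
  with TwoChains.antichain-◁-listing L C₁ C₂ f f-embedding antichain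
... | bs , bs↭as , sorted = bs , bs↭as , MIListings.sorted⇒IsMIListing L ◁-≤-∨ ◁-∧-≤ sorted distrib
  where
  open TwoChains L C₁ C₂ f f-embedding using (◁-≤-∨; ◁-∧-≤)
  open Lattice L using (_≈_; _∧_; _∨_; module Eq)
  generated : ∀ {w} → w ∈ bs → Generated L as w
  generated w∈bs = gen (Any.map Eq.reflexive (∈-resp-↭ bs↭as w∈bs))
  distrib : ∀ {x y z} → x ∈ bs → y ∈ bs → z ∈ bs → x ∧ (y ∨ z) ≈ (x ∧ y) ∨ (x ∧ z)
  distrib x∈ y∈ z∈ =
    antichains-distributive as antichain (generated x∈) (generated y∈) (generated z∈)
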